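{- Let $f_1(x_1,\ldots,x_n),\ldots,f_s(x_1,\ldots,x_n)\in PS$ with $d_{f_1}=\cdots=d_{f_s}=0$, and let $h(x_1,\ldots,x_n)\in R$, $h\not\equiv 0$, satisfy $N_h=N_{f_1}\cap\cdots\cap N_{f_s}$. Then $h\in PS$ and $t_h=\operatorname{lcm}(t_{f_1},\ldots,t_{f_s})$.
   Context: $E_3=\{0,1,2\}$. $R$ is the set of all functions $f(x_1,\ldots,x_n)$ from $E_3^n$ to $\{0,1\}$ such that $f(\tilde\alpha)=0$ for every $\tilde\alpha\in E_3^n\setminus\{1,2\}^n$. $N_f=\{\tilde\alpha : f(\tilde\alpha)=1\}$. $S$ is the set of symmetric (invariant under permutation of variables) functions in $R$. $\mathcal L(e,d)$ is the set of tuples in $\{1,2\}^{e+d}$ with exactly $e$ ones and $d$ twos. A function $f\in S$ of $n$ variables is periodic with period $t$ if there are integers $e_f,d_f\ge0$, $e_f+d_f=n$, $0\le d_f<t$, with $N_f=\bigcup_{i=0}^{s}\mathcal L(e_f-it,d_f+it)$, $s=\lfloor (n-d_f)/t\rfloor$ (i.e. $N_f$ consists of the tuples in $\{1,2\}^n$ whose number of 2s is $\equiv d_f \pmod t$); $t_f$ denotes this period. $PS$ is the set of all nonzero periodic symmetric functions. -}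

module Defs where

open import Data.Nat using (ℕ; zero; suc; _+_; _*_; _∸_; _≤_; _<_)
open import Data.Nat.DivMod using (_/_)
open import Data.Nat.LCM using (lcm)
open import Data.Fin using (Fin; zero; suc)
open import Data.Fin.Permutation using (Permutation′; _⟨$⟩ʳ_)
open import Data.Bool using (Bool; true; false)
open import Data.Product using (Σ; ∃; _×_)
open import Function using (_∘_; _⇔_)
open import Relation.Binary.PropositionalEquality using (_≡_; _≢_)

E₃ : Set
E₃ = Fin 3

Tuple : ℕ → Set
Tuple n = Fin n → E₃

-- functions E₃ⁿ → {0,1}; value 1 is `true`
Func : ℕ → Set
Func n = Tuple n → Bool

_∈N_ : ∀ {n} → Tuple n → Func n → Set
α ∈N f = f α ≡ true

InR : ∀ {n} → Func n → Set
InR {n} f = ∀ (α : Tuple n) (i : Fin n) → α i ≡ zero → f α ≡ false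

Symmetric : ∀ {n} → Func n → Set
Symmetric {n} f = ∀ (π : Permutation′ n) (α : Tuple n) → f (λ i → α (π ⟨$⟩ʳ i)) ≡ f α

InS : ∀ {n} → Func n → Set
InS f = InR f × Symmetric f

NonZeroF : ∀ {n} → Func n → Set
NonZeroF {n} f = ∃ λ (α : Tuple n) → f α ≡ true

In12 : ∀ {n} → Tuple n → Set
In12 {n} α = ∀ (i : Fin n) → α i ≢ zero

ones : ∀ {n} → Tuple n → ℕ
ones {zero} α = 0
ones {suc n} α with α zero
... | suc zero = suc (ones (α ∘ suc))
... | _ = ones (α ∘ suc)

twos : ∀ {n} → Tuple n → ℕ
twos {zero} α = 0
twos {suc n} α with α zero
... | suc (suc zero) = suc (twos (α ∘ suc))
... | _ = twos (α ∘ suc)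

InL : ∀ {n} → ℕ → ℕ → Tuple n → Set
InL {n} e d α = (e + d ≡ n) × In12 α × ones α ≡ e × twos α ≡ d

-- f is periodic with period t and offset d_f = d (e_f = e):
-- N_f = ⋃_{i=0}^{s} 𝓛(e - i t, d + i t),  s = ⌊(n - d)/t⌋
PeriodicWith : ∀ {n} → Func n → (t d : ℕ) → Set
PeriodicWith {n} f t d =
  Σ (d < t) λ d<t →
  Σ ℕ λ e → (e + d ≡ n) ×
    (∀ (α : Tuple n) → α ∈N f ⇔
       (∃ λ (i : ℕ) → i ≤ _/_ (n ∸ d) t {{nz d<t}} × InL (e ∸ i * t) (d + i * t) α))
  where
  open import Data.Nat using (NonZero)
  nz : ∀ {a b} → a < b → NonZero b
  nz {b = suc _} _ = _

Periodic : ∀ {n} → Func n → Set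
Periodic f = ∃ λ t → ∃ λ d → PeriodicWith f t d

InPS : ∀ {n} → Func n → Set
InPS f = InS f × NonZeroF f × Periodic f

lcmF : ∀ {s} → (Fin s → ℕ) → ℕ
lcmF {zero} t = 1
lcmF {suc s} t = lcm (t zero) (lcmF (t ∘ suc))

-- With offset 0 a periodic symmetric function of period t is the indicator of
-- {α ∈ {1,2}ⁿ : t ∣ twos α}. Intersecting such sets intersects the divisibility
-- conditions, and t₁ ∣ m ∧ … ∧ tₛ ∣ m holds exactly when lcm(t₁,…,tₛ) ∣ m.
-- Symmetry of h is inherited from the fᵢ, since N_h is an intersection of
-- permutation-invariant sets.
module Submission where

open import Defs
open import Data.Nat using (ℕ; zero; suc; _+_; _*_; _∸_; _≤_; _<_; NonZero; >-nonZero; ≢-nonZero⁻¹)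
open import Data.Nat.Properties
open import Data.Nat.DivMod using (_/_; m*n/n≡m; /-monoˡ-≤)
open import Data.Nat.Divisibility using (_∣_; divides; ∣-trans; 0∣⇒≡0; m∣m*n; n∣m*n)
open import Data.Nat.LCM using (lcm; m∣lcm[m,n]; n∣lcm[m,n]; lcm-least)
open import Data.Bool.Properties using (⇔→≡)
open import Data.Fin using (Fin; zero; suc)
open import Data.Fin.Permutation using (_⟨$⟩ʳ_)
open import Data.Product using (∃; _×_; _,_; proj₁; proj₂)
open import Data.Empty using (⊥-elim)
open import Function using (_⇔_; mk⇔; _∘_; Equivalence)
open import Relation.Binary.PropositionalEquality
open Equivalence using (to; from)

lcm-pos : ∀ {a b} → 0 < a → 0 < b → 0 < lcm a b
lcm-pos {a} {b} a>0 b>0 = n≢0⇒n>0 λ lcm≡0 →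
  ≢-nonZero⁻¹ (a * b) {{m*n≢0 a b {{>-nonZero a>0}} {{>-nonZero b>0}}}}
    (0∣⇒≡0 (subst (_∣ a * b) lcm≡0 (lcm-least (m∣m*n {a} b) (n∣m*n a))))

lcmF-pos : ∀ {s} (t : Fin s → ℕ) → (∀ k → 0 < t k) → 0 < lcmF t
lcmF-pos {zero}  t t>0 = ≤-refl
lcmF-pos {suc s} t t>0 = lcm-pos (t>0 zero) (lcmF-pos (t ∘ suc) (t>0 ∘ suc))

∣lcmF : ∀ {s} (t : Fin s → ℕ) k → t k ∣ lcmF t
∣lcmF t zero    = m∣lcm[m,n] _ _
∣lcmF t (suc k) = ∣-trans (∣lcmF (t ∘ suc) k) (n∣lcm[m,n] (t zero) _)

lcmF-least : ∀ {s} (t : Fin s → ℕ) {m} → (∀ k → t k ∣ m) → lcmF t ∣ m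
lcmF-least {zero}  t {m} _   = divides m (sym (*-identityʳ m))
lcmF-least {suc s} t     t∣m = lcm-least (t∣m zero) (lcmF-least (t ∘ suc) (t∣m ∘ suc))

lcmF∣⇔ : ∀ {s} (t : Fin s → ℕ) {m} → lcmF t ∣ m ⇔ (∀ k → t k ∣ m)
lcmF∣⇔ t = mk⇔ (λ l∣m k → ∣-trans (∣lcmF t k) l∣m) (lcmF-least t)

ones+twos≡n : ∀ {n} {α : Tuple n} → In12 α → ones α + twos α ≡ n
ones+twos≡n {zero}          _   = refl
ones+twos≡n {suc n} {α} α∈12 with α zero | α∈12 zero
... | zero           | α₀≢0 = ⊥-elim (α₀≢0 refl)
... | suc zero       | _    = cong suc (ones+twos≡n (α∈12 ∘ suc))
... | suc (suc zero) | _    =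
  trans (+-suc (ones (α ∘ suc)) _) (cong suc (ones+twos≡n (α∈12 ∘ suc)))

LayersOf : ∀ {n} (t : ℕ) {{_ : NonZero t}} → Tuple n → Set
LayersOf {n} t α = ∃ λ i → i ≤ n / t × InL (n ∸ i * t) (i * t) α

layersOf⇔ : ∀ {n} t {{_ : NonZero t}} (α : Tuple n) →
            LayersOf t α ⇔ (In12 α × t ∣ twos α)
layersOf⇔ {n} t α = mk⇔ (λ (i , _ , _ , α∈12 , _ , twos≡) → α∈12 , divides i twos≡) layer
  where
  layer : In12 α × t ∣ twos α → LayersOf t α
  layer (α∈12 , divides i twos≡) = i , i≤n/t , m∸n+n≡m it≤n , α∈12 , ones≡ , twos≡
    where
    sum≡n : ones α + twos α ≡ n
    sum≡n = ones+twos≡n α∈12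
    it≤n : i * t ≤ n
    it≤n = subst₂ _≤_ twos≡ sum≡n (m≤n+m (twos α) (ones α))
    i≤n/t : i ≤ n / t
    i≤n/t = subst (_≤ n / t) (m*n/n≡m i t) (/-monoˡ-≤ t it≤n)
    ones≡ : ones α ≡ n ∸ i * t
    ones≡ = trans (sym (m+n∸n≡m (ones α) (twos α))) (cong₂ _∸_ sum≡n twos≡)

periodicWith-zero⇒ : ∀ {n} {f : Func n} {t} → PeriodicWith f t 0 →
                     ∀ α → α ∈N f ⇔ (In12 α × t ∣ twos α)
periodicWith-zero⇒ {n} {f} (t>0 , e , e+0≡n , N-f) α
  rewrite sym (trans (sym (+-identityʳ e)) e+0≡n) =
  let instance _ = >-nonZero t>0 in
  mk⇔ (to (layersOf⇔ _ α) ∘ to (N-f α)) (from (N-f α) ∘ from (layersOf⇔ _ α))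

periodicWith-zero⇐ : ∀ {n} {f : Func n} {t} → 0 < t →
                     (∀ α → α ∈N f ⇔ (In12 α × t ∣ twos α)) → PeriodicWith f t 0
periodicWith-zero⇐ {n} t>0 N-f = t>0 , n , +-identityʳ n , λ α →
  let instance _ = >-nonZero t>0 in
  mk⇔ (from (layersOf⇔ _ α) ∘ to (N-f α)) (from (N-f α) ∘ to (layersOf⇔ _ α))

periodicWith-intersection :
  ∀ {n s} (f : Fin s → Func n) (t : Fin s → ℕ) (h : Func n) → Fin s →
  (∀ k → PeriodicWith (f k) (t k) 0) →
  (∀ α → α ∈N h ⇔ (∀ k → α ∈N f k)) →
  PeriodicWith h (lcmF t) 0
periodicWith-intersection f t h k₀ f-per N-h =
  periodicWith-zero⇐ (lcmF-pos t (proj₁ ∘ f-per)) λ α → mk⇔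
    (λ α∈h → let α∈f k = N-f α k (to (N-h α) α∈h k) in
             proj₁ (α∈f k₀) , from (lcmF∣⇔ t) (proj₂ ∘ α∈f))
    (λ (α∈12 , l∣) → from (N-h α) λ k →
             from (periodicWith-zero⇒ (f-per k) α) (α∈12 , to (lcmF∣⇔ t) l∣ k))
  where
  N-f : ∀ α k → α ∈N f k → In12 α × t k ∣ twos α
  N-f α k = to (periodicWith-zero⇒ (f-per k) α)

symmetric-intersection :
  ∀ {n s} (f : Fin s → Func n) (h : Func n) →
  (∀ k → Symmetric (f k)) →
  (∀ α → α ∈N h ⇔ (∀ k → α ∈N f k)) →
  Symmetric h
symmetric-intersection f h f-sym N-h π α = ⇔→≡ (mk⇔
  (λ πα∈h → from (N-h α) λ k → trans (sym (f-sym k π α)) (to (N-h πα) πα∈h k))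
  (λ α∈h → from (N-h πα) λ k → trans (f-sym k π α) (to (N-h α) α∈h k)))
  where
  πα : Tuple _
  πα i = α (π ⟨$⟩ʳ i)

mainTheorem2 : ∀ (n s : ℕ) → 1 ≤ s →
    (f : Fin s → Func n) (t : Fin s → ℕ) →
    (∀ k → InPS (f k)) →
    (∀ k → PeriodicWith (f k) (t k) 0) →
    (h : Func n) → InR h → NonZeroF h →
    (∀ (α : Tuple n) → α ∈N h ⇔ (∀ k → α ∈N f k)) →
    InPS h × ∃ (λ d → PeriodicWith h (lcmF t) d)
mainTheorem2 n (suc s) _ f t f∈PS f-per h h∈R h≢0 N-h =
  ((h∈R , h-sym) , h≢0 , (lcmF t , 0 , h-per)) , (0 , h-per)
  where
  h-per : PeriodicWith h (lcmF t) 0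
  h-per = periodicWith-intersection f t h zero f-per N-h
  h-sym : Symmetric h
  h-sym = symmetric-intersection f h (proj₂ ∘ proj₁ ∘ f∈PS) N-h
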